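{- Let $D=1$ and $A\ge2$. Let $n$ be a positive integer with standard binary expansion $N_{\mathcal B}=n_\lambda\dots n_0$, $n_\lambda=1$, and let $N^*=n^*_{\lambda+1}\dots n^*_0$ be the output of Algorithm 2 on $N_{\mathcal B}$. Then $$T(N^*,\lambda+1)\le\left(\tfrac12\lambda+1\right)A+D.$$
   Context: Strings are written most significant digit first; $\bar1$ denotes $-1$. In patterns, $x^k$ is $k$ repetitions, $x^*$ zero or more repetitions, and "ends with a pattern" means a suffix matches it. Time model: for a digit string $N=n_\lambda\dots n_0$, define recursively for $0\le i\le\lambda$: $T(N,i)=0$ if $i=0$ and $n_0=0$; $T(N,i)=T(N,i-1)$ if $i>0$ and $n_i=0$; $T(N,i)=iD+(|n_i|-1)A$ if $n_i\ne0$ and $n_j=0$ for all $0\le j<i$; and $T(N,i)=\max(T(N,i-1),iD)+|n_i|A$ otherwise. toNAF$(N,i)$: input a digit string $N=n_\lambda\dots n_0$ and a starting index $i$. Set $n'_j\leftarrow n_j$ for $j\le\lambda$, $n'_{\lambda+1}\leftarrow0$. While $i<\lambda$: if $n'_i=1$ and $n'_{i+1}=1$, set $n'_i\leftarrow-1$, $i\leftarrow i+1$; while $n'_i=1$ set $n'_i\leftarrow0$, $i\leftarrow i+1$; then set $n'_i\leftarrow1$ (continue the outer loop without incrementing $i$). Otherwise $i\leftarrow i+1$. Return $n'_{\lambda+1}\dots n'_0$. Algorithm 2: input $N_{\mathcal B}=n_\lambda\dots n_0$. Let $\ell$ be the index of the least significant $1$. The pattern tests are applied to the string $00n_\lambda\dots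 n_0$. If it ends with $11(01)^*010^*$: set $n_\ell\leftarrow-1$, $n_{\ell+1}\leftarrow1$ and return toNAF$(N_{\mathcal B},\ell+1)$. Else if it ends with $0(01)^*0110^*$: return toNAF$(N_{\mathcal B},\ell+1)$. Else return toNAF$(N_{\mathcal B},\ell)$. -}

module Defs where

open import Data.Nat as ℕ using (ℕ; zero; suc; _⊔_; _∸_; _<?_; _≤?_)
open import Data.Integer as ℤ using (ℤ; +_; -[1+_]; ∣_∣)
open import Data.Bool using (Bool; true; false; _∧_; _∨_; if_then_else_)
open import Data.List using (List; []; _∷_; map; _++_; upTo; foldr)
open import Data.Product using (_×_; _,_)
open import Relation.Nullary.Decidable using (⌊_⌋; yes; no)

-- Digit strings are represented least-significant-first as arrays ℕ → ℤ;
-- position j holds the digit n_j.  The length (top index) is carried separately.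

infix 7 _==_
_==_ : ℤ → ℤ → Bool
x == y = ⌊ x ℤ.≟ y ⌋

allZeroBelow : (ℕ → ℤ) → ℕ → Bool
allZeroBelow N i = foldr (λ j b → (N j == + 0) ∧ b) true (upTo i)

T : (A D : ℕ) → (ℕ → ℤ) → ℕ → ℕ
T A D N zero = if N 0 == + 0 then 0 else 0 ℕ.* D ℕ.+ (∣ N 0 ∣ ∸ 1) ℕ.* A
T A D N (suc i) =
  if N (suc i) == + 0 then T A D N i
  else (if allZeroBelow N (suc i)
        then suc i ℕ.* D ℕ.+ (∣ N (suc i) ∣ ∸ 1) ℕ.* A
        else (T A D N i ⊔ suc i ℕ.* D) ℕ.+ ∣ N (suc i) ∣ ℕ.* A)

upd : (ℕ → ℤ) → ℕ → ℤ → (ℕ → ℤ)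
upd f k v j = if ⌊ j ℕ.≟ k ⌋ then v else f j

inner : ℕ → (ℕ → ℤ) → ℕ → (ℕ → ℤ) × ℕ
inner zero f i = f , i
inner (suc fu) f i = if f i == + 1 then inner fu (upd f i (+ 0)) (suc i) else (f , i)

outer : ℕ → (lam : ℕ) → (ℕ → ℤ) → ℕ → (ℕ → ℤ)
outer zero lam f i = f
outer (suc fu) lam f i with i <? lam
... | no _ = f
... | yes _ with f i == + 1 ∧ f (suc i) == + 1
...   | true with inner (suc (suc lam)) (upd f i -[1+ 0 ]) (suc i)
...     | g , i' = outer fu lam (upd g i' (+ 1)) i'
outer (suc fu) lam f i | yes _ | false = outer fu lam f (suc i)

-- The result n'_{λ+1} … n'_0 is the array
-- restricted to positions ≤ λ+1 (positions above λ+1 are 0).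
-- Fuel: the outer loop increases i by ≥ 1 per iteration and runs while i < λ,
-- so λ+1 iterations suffice; the inner loop runs at most λ+2 iterations.
toNAF : (ℕ → ℤ) → (lam : ℕ) → ℕ → (ℕ → ℤ)
toNAF N lam i = outer (suc lam) lam N₀ i
  where
  N₀ : ℕ → ℤ
  N₀ j = if ⌊ j ≤? lam ⌋ then N j else + 0

-- A regular pattern written msd-first is matched as a suffix of the string,
-- i.e. its reversal is matched as a prefix of the lsf list.
Matcher : Set
Matcher = List ℤ → Bool

accept : Matcher
accept _ = true

lit : ℤ → Matcher → Matcher
lit d k [] = false
lit d k (x ∷ xs) = (x == d) ∧ k xs

star0 : Matcher → Matcher
star0 k [] = k []
star0 k (x ∷ xs) = k (x ∷ xs) ∨ ((x == + 0) ∧ star0 k xs)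

star01 : Matcher → Matcher
star01 k [] = k []
star01 k (x ∷ []) = k (x ∷ [])
star01 k (x ∷ y ∷ xs) = k (x ∷ y ∷ xs) ∨ ((x == + 1) ∧ (y == + 0) ∧ star01 k xs)

-- "ends with 11(01)^*010^*"
endsWithP1 : List ℤ → Bool
endsWithP1 = star0 (lit (+ 1) (lit (+ 0) (star01 (lit (+ 1) (lit (+ 1) accept)))))

-- "ends with 0(01)^*0110^*"
endsWithP2 : List ℤ → Bool
endsWithP2 = star0 (lit (+ 1) (lit (+ 1) (lit (+ 0) (star01 (lit (+ 0) accept)))))

findOne : (ℕ → ℤ) → ℕ → ℕ → ℕ
findOne N j zero = j
findOne N j (suc k) = if N j == + 1 then j else findOne N (suc j) k

lsbIndex : (lam : ℕ) → (ℕ → ℤ) → ℕ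
lsbIndex lam N = findOne N 0 lam

padded : (lam : ℕ) → (ℕ → ℤ) → List ℤ
padded lam N = map N (upTo (suc lam)) ++ (+ 0 ∷ + 0 ∷ [])

algorithm2 : (lam : ℕ) → (ℕ → ℤ) → (ℕ → ℤ)
algorithm2 lam N =
  if endsWithP1 S then toNAF (upd (upd N ℓ -[1+ 0 ]) (suc ℓ) (+ 1)) lam (suc ℓ)
  else (if endsWithP2 S then toNAF N lam (suc ℓ) else toNAF N lam ℓ)
  where
  S = padded lam N
  ℓ = lsbIndex lam N

value : (lam : ℕ) → (ℕ → ℤ) → ℤ
value zero N = N 0
value (suc lam) N = value lam N ℤ.+ N (suc lam) ℤ.* (+ (2 ℕ.^ suc lam))

-- Algorithm 2 outputs a signed-binary string in which no two nonzero digits are adjacent,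
-- except possibly the two least significant ones: the input is binary, the preprocessing
-- only rewrites the lowest 0 1 as 1 1̄, and toNAF, working upwards from the lowest 1 or just
-- above it, only ever replaces a block 0 1^k (k ≥ 2) by 1 0^(k-1) 1̄.  Along such a string
-- T grows by at most A every two positions, since with D = 1 and A ≥ 2 the term iD never
-- dominates; by induction 2 T(N*, i) ≤ (i + 1) A + 2, and even ≤ i A + 2 when n*_i = 0.
module Submission where

open import Defs
open import Data.Nat using (ℕ; _≤_; _<_; _+_; _*_; suc)
open import Data.Integer using (ℤ; +_)
open import Data.Sum using (_⊎_)
open import Relation.Binary.PropositionalEquality using (_≡_)
open import Data.Nat as ℕ using (zero; _⊔_; z≤n; s≤s; _<?_; _≤?_)
open import Data.Nat.Properties
open import Data.Nat.Tactic.RingSolver using (solve-∀)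
open import Data.Integer as ℤ using (-[1+_])
open import Data.Sum using (inj₁; inj₂)
open import Data.Product using (_×_; _,_; proj₁; proj₂)
open import Data.Bool using (true; false; _∧_; if_then_else_)
open import Data.Empty using (⊥-elim)
open import Data.List using ([]; _∷_; foldr; upTo)
open import Data.List.Membership.Propositional using (_∈_)
open import Data.List.Membership.Propositional.Properties using (∈-upTo⁻)
open import Data.List.Relation.Unary.Any using (here; there)
open import Relation.Nullary using (¬_; yes; no)
open import Relation.Nullary.Decidable using (⌊_⌋)
open import Relation.Binary.PropositionalEquality using (refl; sym; trans; cong; cong₂; subst; _≢_)
open import Relation.Binary.Definitions using (tri<; tri≈; tri>)

IsBit : ℤ → Set
IsBit d = d ≡ + 0 ⊎ d ≡ + 1

IsUnit : ℤ → Set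
IsUnit d = d ≡ + 1 ⊎ d ≡ -[1+ 0 ]

IsSignedBit : ℤ → Set
IsSignedBit d = d ≡ + 0 ⊎ IsUnit d

IsUnit⇒≢0 : ∀ {d} → IsUnit d → d ≢ + 0
IsUnit⇒≢0 (inj₁ refl) ()
IsUnit⇒≢0 (inj₂ refl) ()

IsBit⇒IsSignedBit : ∀ {d} → IsBit d → IsSignedBit d
IsBit⇒IsSignedBit (inj₁ d≡0) = inj₁ d≡0
IsBit⇒IsSignedBit (inj₂ d≡1) = inj₂ (inj₁ d≡1)

IsBit∧≢0⇒≡1 : ∀ {d} → IsBit d → d ≢ + 0 → d ≡ + 1
IsBit∧≢0⇒≡1 (inj₁ d≡0) d≢0 = ⊥-elim (d≢0 d≡0)
IsBit∧≢0⇒≡1 (inj₂ d≡1) _   = d≡1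

ZerosBelow : (ℕ → ℤ) → ℕ → Set
ZerosBelow R j = ∀ k → k < j → R k ≡ + 0

AlmostNonAdjacent : (ℕ → ℤ) → ℕ → Set
AlmostNonAdjacent R m = ∀ j → j < m → R j ≢ + 0 → R (suc j) ≢ + 0 → ZerosBelow R j

AlmostNAF : (ℕ → ℤ) → ℕ → Set
AlmostNAF R m = (∀ j → j ≤ m → IsSignedBit (R j)) × AlmostNonAdjacent R m

allZeroBelow-true : ∀ R j → ZerosBelow R j → allZeroBelow R j ≡ true
allZeroBelow-true R j zeros = foldr-true (upTo j) (λ k k∈ → zeros k (∈-upTo⁻ k∈))
  where
  foldr-true : ∀ ks → (∀ k → k ∈ ks → R k ≡ + 0) → foldr (λ k b → (R k == + 0) ∧ b) true ks ≡ true
  foldr-true []       _     = refl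
  foldr-true (k ∷ ks) zeros rewrite zeros k (here refl) = foldr-true ks (λ k′ k′∈ → zeros k′ (there k′∈))

module _ (A : ℕ) (R : ℕ → ℤ) where

  T-zero : ∀ k → R (suc k) ≡ + 0 → T A 1 R (suc k) ≡ T A 1 R k
  T-zero k Rk≡0 rewrite Rk≡0 = refl

  T-unit : ∀ k → IsUnit (R (suc k)) →
    T A 1 R (suc k) ≡ (if allZeroBelow R (suc k) then suc k else (T A 1 R k ⊔ suc k) + A)
  T-unit k unit with allZeroBelow R (suc k)
  T-unit k (inj₁ eq) | true  rewrite eq = trans (+-identityʳ _) (*-identityʳ _)
  T-unit k (inj₂ eq) | true  rewrite eq = trans (+-identityʳ _) (*-identityʳ _)
  T-unit k (inj₁ eq) | false rewrite eq = cong₂ _+_ (cong (T A 1 R k ⊔_) (*-identityʳ _)) (+-identityʳ A)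
  T-unit k (inj₂ eq) | false rewrite eq = cong₂ _+_ (cong (T A 1 R k ⊔_) (*-identityʳ _)) (+-identityʳ A)

  T-0 : IsSignedBit (R 0) → T A 1 R 0 ≡ 0
  T-0 (inj₁ eq)        rewrite eq = refl
  T-0 (inj₂ (inj₁ eq)) rewrite eq = refl
  T-0 (inj₂ (inj₂ eq)) rewrite eq = refl

  T-lowest : ∀ k → IsUnit (R k) → ZerosBelow R k → T A 1 R k ≡ k
  T-lowest zero    unit _     = T-0 (inj₂ unit)
  T-lowest (suc k) unit zeros rewrite T-unit k unit | allZeroBelow-true R (suc k) zeros = refl

2*≤*A : ∀ i {A} → 2 ≤ A → 2 * i ≤ i * A
2*≤*A i {A} 2≤A = subst (_≤ i * A) (*-comm i 2) (*-monoʳ-≤ i 2≤A)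

bound-after-unit : ∀ a i A → 2 ≤ A → 2 * a ≤ i * A + 2 → 2 * ((a ⊔ suc i) + A) ≤ suc (suc i) * A + 2
bound-after-unit a i A 2≤A 2a≤ = begin
  2 * ((a ⊔ suc i) + A)        ≡⟨ *-distribˡ-+ 2 (a ⊔ suc i) A ⟩
  2 * (a ⊔ suc i) + 2 * A      ≡⟨ cong (_+ 2 * A) (*-distribˡ-⊔ 2 a (suc i)) ⟩
  (2 * a ⊔ 2 * suc i) + 2 * A  ≤⟨ +-monoˡ-≤ (2 * A) (⊔-lub 2a≤ 2[1+i]≤) ⟩
  (i * A + 2) + 2 * A          ≡⟨ regroup i A ⟩
  suc (suc i) * A + 2          ∎
  where
  open ≤-Reasoning
  regroup : ∀ i A → (i * A + 2) + 2 * A ≡ suc (suc i) * A + 2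
  regroup = solve-∀
  2[1+i]≤ : 2 * suc i ≤ i * A + 2
  2[1+i]≤ = subst (_≤ i * A + 2) (sym (trans (*-suc 2 i) (+-comm 2 (2 * i)))) (+-monoˡ-≤ 2 (2*≤*A i 2≤A))

-- The second component strengthens the induction: a zero digit at i leaves room for one
-- more addition at i + 1.
T-bound : ∀ A → 2 ≤ A → ∀ R m → AlmostNAF R m → ∀ i → i ≤ m →
  (2 * T A 1 R i ≤ suc i * A + 2) × (R i ≡ + 0 → 2 * T A 1 R i ≤ i * A + 2)
T-bound A 2≤A R m (signed , almostNonAdjacent) = go
  where
  grow : ∀ i → suc i * A + 2 ≤ suc (suc i) * A + 2
  grow i = +-monoˡ-≤ 2 (m≤n+m (suc i * A) A)

  go : ∀ i → i ≤ m → (2 * T A 1 R i ≤ suc i * A + 2) × (R i ≡ + 0 → 2 * T A 1 R i ≤ i * A + 2)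
  go zero 0≤m rewrite T-0 A R (signed 0 0≤m) = z≤n , λ _ → z≤n
  go (suc i) 1+i≤m with go i (≤-trans (n≤1+n i) 1+i≤m) | signed (suc i) 1+i≤m
  ... | IH | inj₁ digit≡0 rewrite T-zero A R i digit≡0 = ≤-trans (proj₁ IH) (grow i) , λ _ → proj₁ IH
  ... | IH | inj₂ unit rewrite T-unit A R i unit with allZeroBelow R (suc i)
  ...   | true  = ≤-trans (2*≤*A (suc i) 2≤A) (≤-trans (m≤m+n (suc i * A) 2) (grow i))
                , λ digit≡0 → ⊥-elim (IsUnit⇒≢0 unit digit≡0)
  ...   | false = bound-after-unit (T A 1 R i) i A 2≤A previous
                , λ digit≡0 → ⊥-elim (IsUnit⇒≢0 unit digit≡0)
    where
    previous : 2 * T A 1 R i ≤ i * A + 2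
    previous with signed i (≤-trans (n≤1+n i) 1+i≤m)
    ... | inj₁ digit≡0 = proj₂ IH digit≡0
    ... | inj₂ unitᵢ rewrite T-lowest A R i unitᵢ
                               (almostNonAdjacent i 1+i≤m (IsUnit⇒≢0 unitᵢ) (IsUnit⇒≢0 unit))
      = ≤-trans (2*≤*A i 2≤A) (m≤m+n (i * A) 2)

upd-≡ : ∀ f k v → upd f k v k ≡ v
upd-≡ f k v with k ℕ.≟ k
... | yes _   = refl
... | no k≢k = ⊥-elim (k≢k refl)

upd-≢ : ∀ f k v {j} → j ≢ k → upd f k v j ≡ f j
upd-≢ f k v {j} j≢k with j ℕ.≟ k
... | yes j≡k = ⊥-elim (j≢k j≡k)
... | no _    = refl

0≢1 : + 0 ≢ + 1
0≢1 ()

record InnerRun (f : ℕ → ℤ) (s : ℕ) (g : ℕ → ℤ) (i′ p : ℕ) : Set where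
  field
    start≤stop : s ≤ i′
    stop≤p     : i′ ≤ p
    stop≢1     : f i′ ≢ + 1
    below      : ∀ j → j < s → g j ≡ f j
    cleared    : ∀ j → s ≤ j → j < i′ → g j ≡ + 0
    above      : ∀ j → i′ ≤ j → g j ≡ f j

inner-run : ∀ fuel f s p → s ≤ p → p ≤ fuel + s → f p ≡ + 0 →
  InnerRun f s (proj₁ (inner fuel f s)) (proj₂ (inner fuel f s)) p
inner-run zero f s p s≤p p≤s fp≡0 = record
  { start≤stop = ≤-refl ; stop≤p = s≤p
  ; stop≢1 = λ fs≡1 → 0≢1 (trans (sym fp≡0) (subst (λ q → f q ≡ + 1) (≤-antisym s≤p p≤s) fs≡1))
  ; below = λ _ _ → refl ; cleared = λ j s≤j j<s → ⊥-elim (<⇒≱ j<s s≤j) ; above = λ _ _ → refl }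
inner-run (suc fuel) f s p s≤p p≤ fp≡0 with f s ℤ.≟ + 1
... | no fs≢1 = record
  { start≤stop = ≤-refl ; stop≤p = s≤p ; stop≢1 = fs≢1
  ; below = λ _ _ → refl ; cleared = λ j s≤j j<s → ⊥-elim (<⇒≱ j<s s≤j) ; above = λ _ _ → refl }
... | yes fs≡1 = record
  { start≤stop = <⇒≤ s<i′
  ; stop≤p     = stop≤p
  ; stop≢1     = λ fi′≡1 → stop≢1 (trans (upd-≢ f s (+ 0) (>⇒≢ s<i′)) fi′≡1)
  ; below      = λ j j<s → trans (below j (m<n⇒m<1+n j<s)) (upd-≢ f s (+ 0) (<⇒≢ j<s))
  ; cleared    = cleared′
  ; above      = λ j i′≤j → trans (above j i′≤j) (upd-≢ f s (+ 0) (>⇒≢ (<-≤-trans s<i′ i′≤j)))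
  }
  where
  s<p : s < p
  s<p = ≤∧≢⇒< s≤p (λ s≡p → 0≢1 (trans (sym fp≡0) (subst (λ q → f q ≡ + 1) s≡p fs≡1)))
  open InnerRun (inner-run fuel (upd f s (+ 0)) (suc s) p s<p (subst (p ≤_) (sym (+-suc fuel s)) p≤)
                  (trans (upd-≢ f s (+ 0) (>⇒≢ s<p)) fp≡0))
  s<i′ : s < proj₂ (inner fuel (upd f s (+ 0)) (suc s))
  s<i′ = start≤stop
  cleared′ : ∀ j → s ≤ j → j < proj₂ (inner fuel (upd f s (+ 0)) (suc s)) →
    proj₁ (inner fuel (upd f s (+ 0)) (suc s)) j ≡ + 0
  cleared′ j s≤j j<i′ with j ℕ.≟ s
  ... | yes refl = trans (below s (n<1+n s)) (upd-≡ f s (+ 0))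
  ... | no j≢s   = cleared j (≤∧≢⇒< s≤j (λ s≡j → j≢s (sym s≡j))) j<i′

record OuterInv (lam : ℕ) (f : ℕ → ℤ) (i : ℕ) : Set where
  field
    signed            : ∀ j → IsSignedBit (f j)
    bitsFrom          : ∀ j → i ≤ j → IsBit (f j)
    zeroAbove         : ∀ j → lam < j → i < j → f j ≡ + 0
    almostNonAdjacent : AlmostNonAdjacent f i

outerInv⇒AlmostNAF : ∀ {lam f i} → lam ≤ i → OuterInv lam f i → AlmostNAF f (suc lam)
outerInv⇒AlmostNAF {lam} {f} {i} lam≤i inv = (λ j _ → signed j) , almostNonAdjacent′
  where
  open OuterInv inv
  almostNonAdjacent′ : AlmostNonAdjacent f (suc lam)
  almostNonAdjacent′ j _ fj≢0 f1+j≢0 with suc j ≤? i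
  ... | yes 1+j≤i = almostNonAdjacent j 1+j≤i fj≢0 f1+j≢0
  ... | no 1+j≰i  = ⊥-elim (f1+j≢0 (zeroAbove (suc j) (s≤s (≤-trans lam≤i (≤-pred i<1+j))) i<1+j))
    where
    i<1+j : i < suc j
    i<1+j = ≰⇒> 1+j≰i

outerInv-skip : ∀ {lam f i} → OuterInv lam f i → ¬ (f i ≡ + 1 × f (suc i) ≡ + 1) →
  OuterInv lam f (suc i)
outerInv-skip {lam} {f} {i} inv not11 = record
  { signed            = signed
  ; bitsFrom          = λ j 1+i≤j → bitsFrom j (≤-trans (n≤1+n i) 1+i≤j)
  ; zeroAbove         = λ j lam<j 1+i<j → zeroAbove j lam<j (<-trans (n<1+n i) 1+i<j)
  ; almostNonAdjacent = almostNonAdjacent′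
  }
  where
  open OuterInv inv
  almostNonAdjacent′ : AlmostNonAdjacent f (suc i)
  almostNonAdjacent′ j j<1+i fj≢0 f1+j≢0 with j ℕ.≟ i
  ... | no j≢i    = almostNonAdjacent j (≤∧≢⇒< (≤-pred j<1+i) j≢i) fj≢0 f1+j≢0
  ... | yes refl = ⊥-elim (not11 ( IsBit∧≢0⇒≡1 (bitsFrom i ≤-refl) fj≢0
                                  , IsBit∧≢0⇒≡1 (bitsFrom (suc i) (n≤1+n i)) f1+j≢0))

data CarryRegion (f f′ : ℕ → ℤ) (i i′ : ℕ) : ℕ → Set where
  before : ∀ {j} → j < i → f′ j ≡ f j → CarryRegion f f′ i i′ j
  start  : f′ i ≡ -[1+ 0 ] → CarryRegion f f′ i i′ i
  run    : ∀ {j} → i < j → j < i′ → f′ j ≡ + 0 → CarryRegion f f′ i i′ j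
  end    : f′ i′ ≡ + 1 → CarryRegion f f′ i i′ i′
  after  : ∀ {j} → i′ < j → f′ j ≡ f j → CarryRegion f f′ i i′ j

module _ {f g i i′ p} (innerRun : InnerRun (upd f i -[1+ 0 ]) (suc i) g i′ p) where
  open InnerRun innerRun

  carryRegion : ∀ j → CarryRegion f (upd g i′ (+ 1)) i i′ j
  carryRegion j with <-cmp j i′
  ... | tri≈ _ refl _ = end (upd-≡ g i′ (+ 1))
  ... | tri> _ j≢i′ i′<j =
    after i′<j (trans (upd-≢ g i′ (+ 1) j≢i′)
                 (trans (above j (<⇒≤ i′<j)) (upd-≢ f i _ (>⇒≢ (<-trans start≤stop i′<j)))))
  ... | tri< j<i′ j≢i′ _ with <-cmp j i
  ...   | tri< j<i _ _ = before j<i (trans (upd-≢ g i′ (+ 1) j≢i′)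
                                     (trans (below j (m<n⇒m<1+n j<i)) (upd-≢ f i _ (<⇒≢ j<i))))
  ...   | tri≈ _ refl _ = start (trans (upd-≢ g i′ (+ 1) j≢i′) (trans (below i (n<1+n i)) (upd-≡ f i _)))
  ...   | tri> _ _ i<j = run i<j j<i′ (trans (upd-≢ g i′ (+ 1) j≢i′) (cleared j i<j j<i′))

outerInv-carry : ∀ {lam f g i i′} → OuterInv lam f i → f i ≡ + 1 → f (suc i) ≡ + 1 →
  InnerRun (upd f i -[1+ 0 ]) (suc i) g i′ (suc lam) → OuterInv lam (upd g i′ (+ 1)) i′
outerInv-carry {lam} {f} {g} {i} {i′} inv fi≡1 f1+i≡1 innerRun = record
  { signed = signed′ ; bitsFrom = bitsFrom′ ; zeroAbove = zeroAbove′
  ; almostNonAdjacent = almostNonAdjacent′ }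
  where
  open OuterInv inv
  f′ : ℕ → ℤ
  f′ = upd g i′ (+ 1)
  region : ∀ j → CarryRegion f f′ i i′ j
  region = carryRegion innerRun
  i<i′ : i < i′
  i<i′ = InnerRun.start≤stop innerRun

  -- The run of ones starting at i has length at least two, so the carry clears position i + 1.
  1+i<i′ : suc i < i′
  1+i<i′ = ≤∧≢⇒< i<i′ λ 1+i≡i′ →
    InnerRun.stop≢1 innerRun (subst (λ q → upd f i -[1+ 0 ] q ≡ + 1) 1+i≡i′
                               (trans (upd-≢ f i _ (>⇒≢ (n<1+n i))) f1+i≡1))

  f′1+i≡0 : f′ (suc i) ≡ + 0
  f′1+i≡0 = trans (upd-≢ g i′ (+ 1) (<⇒≢ 1+i<i′)) (InnerRun.cleared innerRun (suc i) ≤-refl 1+i<i′)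

  agreesBelow : ∀ k → k < i → f′ k ≡ f k
  agreesBelow k k<i with region k
  ... | before _ eq  = eq
  ... | start _      = ⊥-elim (<-irrefl refl k<i)
  ... | run i<k _ _  = ⊥-elim (<-asym i<k k<i)
  ... | end _        = ⊥-elim (<-asym i<i′ k<i)
  ... | after i′<k _ = ⊥-elim (<-asym (<-trans i<i′ i′<k) k<i)

  signed′ : ∀ j → IsSignedBit (f′ j)
  signed′ j with region j
  ... | before _ eq = subst IsSignedBit (sym eq) (signed j)
  ... | start eq    = inj₂ (inj₂ eq)
  ... | run _ _ eq  = inj₁ eq
  ... | end eq      = inj₂ (inj₁ eq)
  ... | after _ eq  = subst IsSignedBit (sym eq) (signed j)

  bitsFrom′ : ∀ j → i′ ≤ j → IsBit (f′ j)
  bitsFrom′ j i′≤j with region j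
  ... | before j<i _  = ⊥-elim (<⇒≱ (<-trans j<i i<i′) i′≤j)
  ... | start _       = ⊥-elim (<⇒≱ i<i′ i′≤j)
  ... | run _ j<i′ _  = ⊥-elim (<⇒≱ j<i′ i′≤j)
  ... | end eq        = inj₂ eq
  ... | after i′<j eq = subst IsBit (sym eq) (bitsFrom j (<⇒≤ (<-trans i<i′ i′<j)))

  zeroAbove′ : ∀ j → lam < j → i′ < j → f′ j ≡ + 0
  zeroAbove′ j lam<j i′<j with region j
  ... | before j<i _ = ⊥-elim (<-asym (<-trans j<i i<i′) i′<j)
  ... | start _      = ⊥-elim (<-asym i<i′ i′<j)
  ... | run _ j<i′ _ = ⊥-elim (<-asym j<i′ i′<j)
  ... | end _        = ⊥-elim (<-irrefl refl i′<j)
  ... | after _ eq   = trans eq (zeroAbove j lam<j (<-trans i<i′ i′<j))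

  almostNonAdjacent′ : AlmostNonAdjacent f′ i′
  almostNonAdjacent′ j j<i′ f′j≢0 f′1+j≢0 with region j
  ... | before j<i eq = λ k k<j → trans (agreesBelow k (<-trans k<j j<i))
                                    (almostNonAdjacent j j<i (λ fj≡0 → f′j≢0 (trans eq fj≡0)) f1+j≢0 k k<j)
    where
    f1+j≢0 : f (suc j) ≢ + 0
    f1+j≢0 with m≤n⇒m<n∨m≡n j<i
    ... | inj₁ 1+j<i = λ f1+j≡0 → f′1+j≢0 (trans (agreesBelow (suc j) 1+j<i) f1+j≡0)
    ... | inj₂ refl  = λ fi≡0 → 0≢1 (trans (sym fi≡0) fi≡1)
  ... | start _       = ⊥-elim (f′1+j≢0 f′1+i≡0)
  ... | run _ _ eq    = ⊥-elim (f′j≢0 eq)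
  ... | end _         = ⊥-elim (<-irrefl refl j<i′)
  ... | after i′<j _  = ⊥-elim (<-asym i′<j j<i′)

outer-almostNAF : ∀ fuel lam f i → lam ≤ fuel + i → OuterInv lam f i →
  AlmostNAF (outer fuel lam f i) (suc lam)
outer-almostNAF zero lam f i lam≤i inv = outerInv⇒AlmostNAF lam≤i inv
outer-almostNAF (suc fuel) lam f i lam≤ inv with i <? lam
... | no i≮lam = outerInv⇒AlmostNAF (≮⇒≥ i≮lam) inv
... | yes i<lam with f i ℤ.≟ + 1 | f (suc i) ℤ.≟ + 1
...   | no fi≢1 | _ = outer-almostNAF fuel lam f (suc i) (subst (lam ≤_) (sym (+-suc fuel i)) lam≤)
                                    (outerInv-skip inv (λ ones → fi≢1 (proj₁ ones)))
...   | yes _ | no f1+i≢1 = outer-almostNAF fuel lam f (suc i) (subst (lam ≤_) (sym (+-suc fuel i)) lam≤)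
                                          (outerInv-skip inv (λ ones → f1+i≢1 (proj₂ ones)))
...   | yes fi≡1 | yes f1+i≡1
  with inner (suc (suc lam)) (upd f i -[1+ 0 ]) (suc i)
     | inner-run (suc (suc lam)) (upd f i -[1+ 0 ]) (suc i) (suc lam)
         (m<n⇒m<1+n i<lam) (≤-trans (n≤1+n (suc lam)) (m≤m+n (suc (suc lam)) (suc i)))
         (trans (upd-≢ f i _ (>⇒≢ (m<n⇒m<1+n i<lam)))
                (OuterInv.zeroAbove inv (suc lam) (n<1+n lam) (m<n⇒m<1+n i<lam)))
...     | g , i′ | innerRun =
  outer-almostNAF fuel lam (upd g i′ (+ 1)) i′ lam≤′ (outerInv-carry inv fi≡1 f1+i≡1 innerRun)
  where
  lam≤′ : lam ≤ fuel + i′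
  lam≤′ = ≤-trans lam≤ (subst (_≤ fuel + i′) (+-suc fuel i) (+-monoʳ-≤ fuel (InnerRun.start≤stop innerRun)))

toNAF-almostNAF : ∀ lam f s ℓ → ℓ ≤ lam → s ≤ suc ℓ → ZerosBelow f ℓ →
  (∀ j → j ≤ lam → IsSignedBit (f j)) → (∀ j → s ≤ j → j ≤ lam → IsBit (f j)) →
  AlmostNAF (toNAF f lam s) (suc lam)
toNAF-almostNAF lam f s ℓ ℓ≤lam s≤1+ℓ zeros signed bits =
  outer-almostNAF (suc lam) lam f₀ s (≤-trans (n≤1+n lam) (m≤m+n (suc lam) s)) record
    { signed            = signed₀
    ; bitsFrom          = bitsFrom₀
    ; zeroAbove         = λ j lam<j _ → f₀-above j (<⇒≱ lam<j)
    ; almostNonAdjacent = almostNonAdjacent₀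
    }
  where
  f₀ : ℕ → ℤ
  f₀ j = if ⌊ j ≤? lam ⌋ then f j else + 0

  f₀-below : ∀ j → j ≤ lam → f₀ j ≡ f j
  f₀-below j j≤lam with j ≤? lam
  ... | yes _    = refl
  ... | no j≰lam = ⊥-elim (j≰lam j≤lam)

  f₀-above : ∀ j → ¬ j ≤ lam → f₀ j ≡ + 0
  f₀-above j j≰lam with j ≤? lam
  ... | yes j≤lam = ⊥-elim (j≰lam j≤lam)
  ... | no _      = refl

  signed₀ : ∀ j → IsSignedBit (f₀ j)
  signed₀ j with j ≤? lam
  ... | yes j≤lam = signed j j≤lam
  ... | no _      = inj₁ refl

  bitsFrom₀ : ∀ j → s ≤ j → IsBit (f₀ j)
  bitsFrom₀ j s≤j with j ≤? lam
  ... | yes j≤lam = bits j s≤j j≤lam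
  ... | no _      = inj₁ refl

  zeros₀ : ZerosBelow f₀ ℓ
  zeros₀ k k<ℓ = trans (f₀-below k (≤-trans (<⇒≤ k<ℓ) ℓ≤lam)) (zeros k k<ℓ)

  almostNonAdjacent₀ : AlmostNonAdjacent f₀ s
  almostNonAdjacent₀ j j<s f₀j≢0 _ with m≤n⇒m<n∨m≡n (≤-pred (≤-trans j<s s≤1+ℓ))
  ... | inj₁ j<ℓ = ⊥-elim (f₀j≢0 (zeros₀ j j<ℓ))
  ... | inj₂ refl = zeros₀

findOne-spec : ∀ N j k → findOne N j k ≤ j + k × (∀ m → j ≤ m → m < findOne N j k → N m ≢ + 1)
findOne-spec N j zero = m≤m+n j 0 , λ m j≤m m<j → ⊥-elim (<⇒≱ m<j j≤m)
findOne-spec N j (suc k) with N j ℤ.≟ + 1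
... | yes _ = m≤m+n j (suc k) , λ m j≤m m<j → ⊥-elim (<⇒≱ m<j j≤m)
... | no Nj≢1 with findOne-spec N (suc j) k
...   | bound , not1 = subst (findOne N (suc j) k ≤_) (sym (+-suc j k)) bound , not1′
  where
  not1′ : ∀ m → j ≤ m → m < findOne N (suc j) k → N m ≢ + 1
  not1′ m j≤m m< with m ℕ.≟ j
  ... | yes refl = Nj≢1
  ... | no m≢j   = not1 m (≤∧≢⇒< j≤m (λ j≡m → m≢j (sym j≡m))) m<

lsbIndex-spec : ∀ lam N → (∀ j → j ≤ lam → IsBit (N j)) →
  lsbIndex lam N ≤ lam × ZerosBelow N (lsbIndex lam N)
lsbIndex-spec lam N bits = ℓ≤lam , zeros
  where
  ℓ≤lam = proj₁ (findOne-spec N 0 lam)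
  zeros : ZerosBelow N (lsbIndex lam N)
  zeros k k<ℓ with bits k (≤-trans (<⇒≤ k<ℓ) ℓ≤lam)
  ... | inj₁ Nk≡0 = Nk≡0
  ... | inj₂ Nk≡1 = ⊥-elim (proj₂ (findOne-spec N 0 lam) k z≤n k<ℓ Nk≡1)

algorithm2-almostNAF : ∀ lam N → (∀ j → j ≤ lam → IsBit (N j)) → AlmostNAF (algorithm2 lam N) (suc lam)
algorithm2-almostNAF lam N bits = result
  where
  ℓ : ℕ
  ℓ = lsbIndex lam N
  ℓ≤lam : ℓ ≤ lam
  ℓ≤lam = proj₁ (lsbIndex-spec lam N bits)
  zeros : ZerosBelow N ℓ
  zeros = proj₂ (lsbIndex-spec lam N bits)

  fromBits : ∀ s → s ≤ suc ℓ → AlmostNAF (toNAF N lam s) (suc lam)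
  fromBits s s≤1+ℓ = toNAF-almostNAF lam N s ℓ ℓ≤lam s≤1+ℓ zeros
    (λ j j≤lam → IsBit⇒IsSignedBit (bits j j≤lam)) (λ j _ j≤lam → bits j j≤lam)

  N₁ : ℕ → ℤ
  N₁ = upd (upd N ℓ -[1+ 0 ]) (suc ℓ) (+ 1)

  signed₁ : ∀ j → j ≤ lam → IsSignedBit (N₁ j)
  signed₁ j j≤lam with j ℕ.≟ suc ℓ | j ℕ.≟ ℓ
  ... | yes refl | _        = inj₂ (inj₁ refl)
  ... | no _     | yes refl = inj₂ (inj₂ refl)
  ... | no _     | no _     = IsBit⇒IsSignedBit (bits j j≤lam)

  bits₁ : ∀ j → suc ℓ ≤ j → j ≤ lam → IsBit (N₁ j)
  bits₁ j 1+ℓ≤j j≤lam with j ℕ.≟ suc ℓ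
  ... | yes refl  = inj₂ refl
  ... | no j≢1+ℓ = subst IsBit (sym (upd-≢ N ℓ -[1+ 0 ] (>⇒≢ 1+ℓ≤j))) (bits j j≤lam)

  zeros₁ : ZerosBelow N₁ ℓ
  zeros₁ k k<ℓ = trans (upd-≢ (upd N ℓ -[1+ 0 ]) (suc ℓ) (+ 1) (<⇒≢ (m<n⇒m<1+n k<ℓ)))
                       (trans (upd-≢ N ℓ -[1+ 0 ] (<⇒≢ k<ℓ)) (zeros k k<ℓ))

  result : AlmostNAF (algorithm2 lam N) (suc lam)
  result with endsWithP1 (padded lam N) | endsWithP2 (padded lam N)
  ... | true  | _     = toNAF-almostNAF lam N₁ (suc ℓ) ℓ ℓ≤lam ≤-refl zeros₁ signed₁ bits₁
  ... | false | true  = fromBits (suc ℓ) ≤-refl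
  ... | false | false = fromBits ℓ (n≤1+n ℓ)

corollary1 : (A : ℕ) → 2 ≤ A →
    (n : ℕ) → 0 < n →
    (lam : ℕ) (N : ℕ → ℤ) →
    (∀ j → j ≤ lam → N j ≡ + 0 ⊎ N j ≡ + 1) →
    N lam ≡ + 1 →
    value lam N ≡ + n →
    2 * T A 1 (algorithm2 lam N) (suc lam) ≤ (lam + 2) * A + 2
corollary1 A 2≤A _ _ lam N bits _ _ =
  subst (λ k → 2 * T A 1 (algorithm2 lam N) (suc lam) ≤ k * A + 2) (+-comm 2 lam)
    (proj₁ (T-bound A 2≤A (algorithm2 lam N) (suc lam) (algorithm2-almostNAF lam N bits) (suc lam) ≤-refl))
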